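{- $\Gamma(2)^2=\Gamma(4)$.
   Context: $\Gamma(N)=\{A\in\mathrm{SL}_2(\mathbb Z):A\equiv1\pmod N\}$. For a subgroup $\Gamma\le\mathrm{SL}_2(\mathbb Z)$, $\Gamma^2$ denotes the subgroup generated by the squares of elements of $\Gamma$. -}

module Defs where

open import Data.Nat using (ℕ)
open import Data.Integer using (ℤ; +_; _+_; _-_; _*_; -_; 0ℤ; 1ℤ)
open import Data.Integer.Divisibility using (_∣_)
open import Data.Product using (_×_)
open import Relation.Binary.PropositionalEquality using (_≡_)

record Mat : Set where
  constructor mat
  field
    a b c d : ℤ
open Mat public

_⊗_ : Mat → Mat → Mat
mat a₁ b₁ c₁ d₁ ⊗ mat a₂ b₂ c₂ d₂ =
  mat (a₁ * a₂ + b₁ * c₂) (a₁ * b₂ + b₁ * d₂)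
      (c₁ * a₂ + d₁ * c₂) (c₁ * b₂ + d₁ * d₂)

I₂ : Mat
I₂ = mat 1ℤ 0ℤ 0ℤ 1ℤ

det : Mat → ℤ
det (mat a b c d) = a * d - b * c

-- adjugate; equals the inverse for matrices of determinant 1
adj : Mat → Mat
adj (mat a b c d) = mat d (- b) (- c) a

InSL2 : Mat → Set
InSL2 A = det A ≡ 1ℤ

InΓ : ℕ → Mat → Set
InΓ N (mat a b c d) =
  InSL2 (mat a b c d) ×
  ((+ N) ∣ (a - 1ℤ)) × ((+ N) ∣ b) × ((+ N) ∣ c) × ((+ N) ∣ (d - 1ℤ))

data InΓ2Sq : Mat → Set where
  sq  : ∀ A → InΓ 2 A → InΓ2Sq (A ⊗ A)
  one : InΓ2Sq I₂
  mul : ∀ {A B} → InΓ2Sq A → InΓ2Sq B → InΓ2Sq (A ⊗ B)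
  inv : ∀ {A} → InΓ2Sq A → InΓ2Sq (adj A)

module Submission where

-- Squares of elements I + 2X of Γ(2) are I + 4(X + X²), so Γ(2)² ⊆ Γ(4). Conversely, modulo Γ(2)²
-- the matrices T = (1 2; 0 1) and U = (1 0; 2 1) have order two and commute (a commutator is a
-- product of squares), so right multiplication by T^±1 and U^±1 permutes the four cosets
-- Γ(2)² T^i U^j. For A ∈ Γ(2) with a ≡ 1 (mod 4), the Euclidean algorithm on the first row (a, b),
-- carried out by these column operations, keeps a ≡ 1 (mod 4) and stops at b = 0, i.e. at
-- (1 0; 2r + 4q 1) = (1 0; 2q 1)² U^r. Hence A ∈ Γ(2)² T^i U^j, and if A ∈ Γ(4) then T^i U^j ∈ Γ(4),
-- which forces i = j = 0.

open import Defs
open import Data.Bool using (Bool; true; false; not)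
open import Data.Empty using (⊥; ⊥-elim)
open import Data.Nat as ℕ using (ℕ; suc; s≤s)
import Data.Nat.Properties as ℕ
import Data.Nat.Divisibility as ℕ
open import Data.Integer
  using (ℤ; +_; -[1+_]; _+_; _-_; _*_; -_; 0ℤ; 1ℤ; ∣_∣; _⊖_; _◃_; _≟_; _%ℕ_; _/ℕ_)
open import Data.Integer.Properties
  using (abs-*; *-identityˡ; +-identityʳ; ∣i∣≡0⇒i≡0; ∣m⊖n∣≡∣n⊖m∣; ⊖-≥; ∣⊖∣-≰)
open import Data.Integer.Divisibility.Signed
  using (_∣_; divides; ∣ᵤ⇒∣; ∣⇒∣ᵤ; ∣m∣n⇒∣m+n; ∣m∣n⇒∣m-n; ∣m⇒∣m*n; ∣n⇒∣m*n; ∣m⇒∣-m)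
open import Data.Integer.DivMod using (n%ℕd<d; a≡a%ℕn+[a/ℕn]*n)
open import Data.Integer.Tactic.RingSolver using (solve-∀)
open import Data.Product using (Σ; ∃-syntax; ∃₂; _×_; _,_; proj₁)
import Data.Sign as Sign
open import Relation.Binary.Definitions using (tri<; tri≈; tri>)
open import Relation.Binary.PropositionalEquality
open import Relation.Nullary using (¬_; Dec; yes; no)
open import Relation.Nullary.Decidable using (True; toWitness; _×-dec_)

mat-cong : ∀ {a b c d a′ b′ c′ d′} → a ≡ a′ → b ≡ b′ → c ≡ c′ → d ≡ d′ →
           mat a b c d ≡ mat a′ b′ c′ d′
mat-cong refl refl refl refl = refl

⊗-assoc : ∀ A B C → (A ⊗ B) ⊗ C ≡ A ⊗ (B ⊗ C)
⊗-assoc (mat a₁ b₁ c₁ d₁) (mat a₂ b₂ c₂ d₂) (mat a₃ b₃ c₃ d₃) = mat-cong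
  (entry a₁ b₁ a₂ b₂ c₂ d₂ a₃ c₃) (entry a₁ b₁ a₂ b₂ c₂ d₂ b₃ d₃)
  (entry c₁ d₁ a₂ b₂ c₂ d₂ a₃ c₃) (entry c₁ d₁ a₂ b₂ c₂ d₂ b₃ d₃)
  where
  entry : ∀ x y a b c d z w →
          (x * a + y * c) * z + (x * b + y * d) * w ≡ x * (a * z + b * w) + y * (c * z + d * w)
  entry = solve-∀

⊗-identityˡ : ∀ A → I₂ ⊗ A ≡ A
⊗-identityˡ (mat a b c d) = mat-cong (entry a c) (entry b d) (entry′ a c) (entry′ b d)
  where
  entry : ∀ x y → 1ℤ * x + 0ℤ * y ≡ x
  entry = solve-∀
  entry′ : ∀ x y → 0ℤ * x + 1ℤ * y ≡ y
  entry′ = solve-∀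

⊗-identityʳ : ∀ A → A ⊗ I₂ ≡ A
⊗-identityʳ (mat a b c d) = mat-cong (entry a b) (entry′ a b) (entry c d) (entry′ c d)
  where
  entry : ∀ x y → x * 1ℤ + y * 0ℤ ≡ x
  entry = solve-∀
  entry′ : ∀ x y → x * 0ℤ + y * 1ℤ ≡ y
  entry′ = solve-∀

det-⊗ : ∀ A B → det (A ⊗ B) ≡ det A * det B
det-⊗ (mat a₁ b₁ c₁ d₁) (mat a₂ b₂ c₂ d₂) = identity a₁ b₁ c₁ d₁ a₂ b₂ c₂ d₂
  where
  identity : ∀ a b c d e f g h →
    (a * e + b * g) * (c * f + d * h) - (a * f + b * h) * (c * e + d * g) ≡
    (a * d - b * c) * (e * h - f * g)
  identity = solve-∀

det-adj : ∀ A → det (adj A) ≡ det A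
det-adj (mat a b c d) = identity a b c d
  where
  identity : ∀ a b c d → d * a - (- b) * (- c) ≡ a * d - b * c
  identity = solve-∀

adj-inverseˡ : ∀ A → det A ≡ 1ℤ → adj A ⊗ A ≡ I₂
adj-inverseˡ (mat a b c d) det≡1 = mat-cong
  (trans (diagonal a b c d) det≡1) (off-diagonal d b)
  (off-diagonal′ c a)              (trans (diagonal′ a b c d) det≡1)
  where
  diagonal : ∀ a b c d → d * a + - b * c ≡ a * d - b * c
  diagonal = solve-∀
  diagonal′ : ∀ a b c d → - c * b + a * d ≡ a * d - b * c
  diagonal′ = solve-∀
  off-diagonal : ∀ x y → x * y + - y * x ≡ 0ℤ
  off-diagonal = solve-∀
  off-diagonal′ : ∀ x y → - x * y + y * x ≡ 0ℤ
  off-diagonal′ = solve-∀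

adj-cancelˡ : ∀ A B → det A ≡ 1ℤ → adj A ⊗ (A ⊗ B) ≡ B
adj-cancelˡ A B det≡1 = begin
  adj A ⊗ (A ⊗ B) ≡⟨ ⊗-assoc (adj A) A B ⟨
  (adj A ⊗ A) ⊗ B ≡⟨ cong (_⊗ B) (adj-inverseˡ A det≡1) ⟩
  I₂ ⊗ B          ≡⟨ ⊗-identityˡ B ⟩
  B               ∎
  where open ≡-Reasoning

adj-cancelʳ : ∀ A B → det A ≡ 1ℤ → (B ⊗ adj A) ⊗ A ≡ B
adj-cancelʳ A B det≡1 = begin
  (B ⊗ adj A) ⊗ A ≡⟨ ⊗-assoc B (adj A) A ⟩
  B ⊗ (adj A ⊗ A) ≡⟨ cong (B ⊗_) (adj-inverseˡ A det≡1) ⟩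
  B ⊗ I₂          ≡⟨ ⊗-identityʳ B ⟩
  B               ∎
  where open ≡-Reasoning

-- The congruence subgroups Γ(N)

InΓ⇒∣ : ∀ {N} A → InΓ N A →
        (+ N ∣ a A - 1ℤ) × (+ N ∣ b A) × (+ N ∣ c A) × (+ N ∣ d A - 1ℤ)
InΓ⇒∣ _ (_ , N∣a-1 , N∣b , N∣c , N∣d-1) = ∣ᵤ⇒∣ N∣a-1 , ∣ᵤ⇒∣ N∣b , ∣ᵤ⇒∣ N∣c , ∣ᵤ⇒∣ N∣d-1

∣⇒InΓ : ∀ {N} A → det A ≡ 1ℤ →
        + N ∣ a A - 1ℤ → + N ∣ b A → + N ∣ c A → + N ∣ d A - 1ℤ → InΓ N A
∣⇒InΓ _ det≡1 N∣a-1 N∣b N∣c N∣d-1 = det≡1 , ∣⇒∣ᵤ N∣a-1 , ∣⇒∣ᵤ N∣b , ∣⇒∣ᵤ N∣c , ∣⇒∣ᵤ N∣d-1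

InΓ? : ∀ N A → Dec (InΓ N A)
InΓ? N A@(mat a b c d) =
  (det A ≟ 1ℤ) ×-dec (N ℕ.∣? ∣ a - 1ℤ ∣) ×-dec (N ℕ.∣? ∣ b ∣) ×-dec (N ℕ.∣? ∣ c ∣) ×-dec (N ℕ.∣? ∣ d - 1ℤ ∣)

Γ-I₂ : ∀ N → InΓ N I₂
Γ-I₂ N = refl , N ℕ.∣0 , N ℕ.∣0 , N ℕ.∣0 , N ℕ.∣0

Γ-⊗ : ∀ {N} A B → InΓ N A → InΓ N B → InΓ N (A ⊗ B)
Γ-⊗ {N} A@(mat a b c d) B@(mat a′ b′ c′ d′) γ γ′
  with InΓ⇒∣ A γ | InΓ⇒∣ B γ′
... | N∣a-1 , N∣b , N∣c , N∣d-1 | N∣a′-1 , N∣b′ , N∣c′ , N∣d′-1 = ∣⇒InΓ (A ⊗ B)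
  (trans (det-⊗ A B) (cong₂ _*_ (proj₁ γ) (proj₁ γ′)))
  (subst (+ N ∣_) (diagonal a b a′ c′) (∣m∣n⇒∣m+n (∣m∣n⇒∣m+n (∣m⇒∣m*n a′ N∣a-1) N∣a′-1) (∣n⇒∣m*n b N∣c′)))
  (∣m∣n⇒∣m+n (∣n⇒∣m*n a N∣b′) (∣m⇒∣m*n d′ N∣b))
  (∣m∣n⇒∣m+n (∣m⇒∣m*n a′ N∣c) (∣n⇒∣m*n d N∣c′))
  (subst (+ N ∣_) (diagonal′ c d b′ d′) (∣m∣n⇒∣m+n (∣m⇒∣m*n b′ N∣c) (∣m∣n⇒∣m+n (∣m⇒∣m*n d′ N∣d-1) N∣d′-1)))
  where
  diagonal : ∀ x y z w → (x - 1ℤ) * z + (z - 1ℤ) + y * w ≡ (x * z + y * w) - 1ℤ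
  diagonal = solve-∀
  diagonal′ : ∀ x y z w → x * z + ((y - 1ℤ) * w + (w - 1ℤ)) ≡ (x * z + y * w) - 1ℤ
  diagonal′ = solve-∀

Γ-adj : ∀ {N} A → InΓ N A → InΓ N (adj A)
Γ-adj A γ with InΓ⇒∣ A γ
... | N∣a-1 , N∣b , N∣c , N∣d-1 =
  ∣⇒InΓ (adj A) (trans (det-adj A) (proj₁ γ)) N∣d-1 (∣m⇒∣-m N∣b) (∣m⇒∣-m N∣c) N∣a-1

Γ4⊆Γ2 : ∀ {A} → InΓ 4 A → InΓ 2 A
Γ4⊆Γ2 (det≡1 , 4∣a-1 , 4∣b , 4∣c , 4∣d-1) =
  det≡1 , weaken 4∣a-1 , weaken 4∣b , weaken 4∣c , weaken 4∣d-1
  where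
  weaken : ∀ {n} → 4 ℕ.∣ n → 2 ℕ.∣ n
  weaken = ℕ.∣-trans (ℕ.divides 2 refl)

even*even : ∀ {x y} → + 2 ∣ x → + 2 ∣ y → + 4 ∣ x * y
even*even (divides p refl) (divides q refl) = divides (p * q) (identity p q)
  where
  identity : ∀ p q → (p * + 2) * (q * + 2) ≡ (p * q) * + 4
  identity = solve-∀

odd⇒2∣+1 : ∀ x → + 2 ∣ x - 1ℤ → + 2 ∣ x + 1ℤ
odd⇒2∣+1 x 2∣x-1 = subst (+ 2 ∣_) (identity x) (∣m∣n⇒∣m+n 2∣x-1 (divides 1ℤ refl))
  where
  identity : ∀ x → (x - 1ℤ) + + 2 ≡ x + 1ℤ
  identity = solve-∀

Γ-square : ∀ {A} → InΓ 2 A → InΓ 4 (A ⊗ A)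
Γ-square {A@(mat a b c d)} γ with InΓ⇒∣ A γ
... | 2∣a-1 , 2∣b , 2∣c , 2∣d-1 = ∣⇒InΓ (A ⊗ A) (proj₁ (Γ-⊗ A A γ γ))
  (subst (+ 4 ∣_) (diagonal a b c) (∣m∣n⇒∣m+n (even*even 2∣a-1 (odd⇒2∣+1 a 2∣a-1)) (even*even 2∣b 2∣c)))
  (subst (+ 4 ∣_) (off-diagonal b a d) (even*even 2∣b 2∣a+d))
  (subst (+ 4 ∣_) (off-diagonal′ c a d) (even*even 2∣c 2∣a+d))
  (subst (+ 4 ∣_) (diagonal′ d c b) (∣m∣n⇒∣m+n (even*even 2∣c 2∣b) (even*even 2∣d-1 (odd⇒2∣+1 d 2∣d-1))))
  where
  2∣a+d : + 2 ∣ a + d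
  2∣a+d = subst (+ 2 ∣_) (sum a d) (∣m∣n⇒∣m+n 2∣a-1 (odd⇒2∣+1 d 2∣d-1))
    where
    sum : ∀ a d → (a - 1ℤ) + (d + 1ℤ) ≡ a + d
    sum = solve-∀
  diagonal : ∀ x y z → (x - 1ℤ) * (x + 1ℤ) + y * z ≡ (x * x + y * z) - 1ℤ
  diagonal = solve-∀
  diagonal′ : ∀ x y z → y * z + (x - 1ℤ) * (x + 1ℤ) ≡ (y * z + x * x) - 1ℤ
  diagonal′ = solve-∀
  off-diagonal : ∀ x y z → x * (y + z) ≡ y * x + x * z
  off-diagonal = solve-∀
  off-diagonal′ : ∀ x y z → x * (y + z) ≡ x * y + z * x
  off-diagonal′ = solve-∀

Γ2²⊆Γ4 : ∀ {A} → InΓ2Sq A → InΓ 4 A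
Γ2²⊆Γ4 (sq A γ)          = Γ-square {A} γ
Γ2²⊆Γ4 one               = Γ-I₂ 4
Γ2²⊆Γ4 (mul {A} {B} p q) = Γ-⊗ A B (Γ2²⊆Γ4 p) (Γ2²⊆Γ4 q)
Γ2²⊆Γ4 (inv {A} p)       = Γ-adj A (Γ2²⊆Γ4 p)

4∤2 : ¬ 4 ℕ.∣ 2
4∤2 4∣2 with ℕ.∣⇒≤ 4∣2
... | s≤s (s≤s ())

2∤1 : ¬ 2 ℕ.∣ 1
2∤1 2∣1 with ℕ.∣1⇒≡1 2∣1
... | ()

odd-nonzero : ∀ a → + 2 ∣ a - 1ℤ → 0 ℕ.< ∣ a ∣
odd-nonzero (+ 0)     2∣-1 = ⊥-elim (2∤1 (∣⇒∣ᵤ 2∣-1))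
odd-nonzero (+ suc _) _    = ℕ.z<s
odd-nonzero -[1+ _ ]  _    = ℕ.z<s

odd≢even : ∀ a b → ∣ a ∣ ≡ ∣ b ∣ → + 2 ∣ a - 1ℤ → + 2 ∣ b → ⊥
odd≢even a b |a|≡|b| 2∣a-1 2∣b =
  2∤1 (∣⇒∣ᵤ (subst (+ 2 ∣_) (identity a) (∣m∣n⇒∣m-n 2∣a 2∣a-1)))
  where
  2∣a : + 2 ∣ a
  2∣a = ∣ᵤ⇒∣ (subst (2 ℕ.∣_) (sym |a|≡|b|) (∣⇒∣ᵤ 2∣b))
  identity : ∀ a → a - (a - 1ℤ) ≡ 1ℤ
  identity = solve-∀

unit≡1 : ∀ a → ∣ a ∣ ≡ 1 → + 4 ∣ a - 1ℤ → a ≡ 1ℤ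
unit≡1 (+ 1)              _  _    = refl
unit≡1 -[1+ 0 ]           _  4∣-2 = ⊥-elim (4∤2 (∣⇒∣ᵤ 4∣-2))
unit≡1 (+ 0)              () _
unit≡1 (+ suc (suc _))    () _
unit≡1 -[1+ suc _ ]       () _

∣⊖double∣< : ∀ {m q} → 0 ℕ.< m → m ℕ.< q → ∣ q ⊖ m ℕ.* 2 ∣ ℕ.< q
∣⊖double∣< {m} {q} 0<m m<q with m ℕ.* 2 ℕ.≤? q
... | yes 2m≤q = subst (ℕ._< q) (sym (cong ∣_∣ (⊖-≥ 2m≤q))) (ℕ.∸-monoʳ-< (ℕ.*-monoˡ-< 2 0<m) 2m≤q)
... | no  2m≰q = subst (ℕ._< q) (sym (∣⊖∣-≰ 2m≰q))
                   (ℕ.m<n+o⇒m∸n<o (m ℕ.* 2) q {{ℕ.>-nonZero (ℕ.<-trans 0<m m<q)}}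
                     (subst (m ℕ.* 2 ℕ.<_) (double q) (ℕ.*-monoˡ-< 2 m<q)))
  where
  double : ∀ n → n ℕ.* 2 ≡ n ℕ.+ n
  double n = trans (ℕ.*-comm n 2) (cong (n ℕ.+_) (ℕ.+-identityʳ n))

-- With s opposite to sign x · sign y, y + x * (s ◃ 2) reduces to ∣ y ∣ ⊖ 2∣ x ∣ or to 2∣ x ∣ ⊖ ∣ y ∣.
euclid-step : ∀ x y → 0 ℕ.< ∣ x ∣ → ∣ x ∣ ℕ.< ∣ y ∣ → ∃[ s ] ∣ y + x * (s ◃ 2) ∣ ℕ.< ∣ y ∣
euclid-step (+ suc m) (+ q)     0<m m<q = Sign.- , ∣⊖double∣< 0<m m<q
euclid-step -[1+ m ]  (+ q)     0<m m<q = Sign.+ , ∣⊖double∣< 0<m m<q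
euclid-step (+ suc m) -[1+ q ]  0<m m<q =
  Sign.+ , subst (ℕ._< suc q) (∣m⊖n∣≡∣n⊖m∣ (suc q) (suc m ℕ.* 2)) (∣⊖double∣< 0<m m<q)
euclid-step -[1+ m ]  -[1+ q ]  0<m m<q =
  Sign.- , subst (ℕ._< suc q) (∣m⊖n∣≡∣n⊖m∣ (suc q) (suc m ℕ.* 2)) (∣⊖double∣< 0<m m<q)

-- Cosets of Γ(2)² and the representatives T^i U^j

infix 4 _~_

_~_ : Mat → Mat → Set
A ~ B = Σ Mat λ H → InΓ2Sq H × A ≡ H ⊗ B

~-trans : ∀ {A B C} → A ~ B → B ~ C → A ~ C
~-trans {A} {B} {C} (H , h , A≡HB) (H′ , h′ , B≡H′C) = H ⊗ H′ , mul h h′ , (begin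
  A              ≡⟨ A≡HB ⟩
  H ⊗ B          ≡⟨ cong (H ⊗_) B≡H′C ⟩
  H ⊗ (H′ ⊗ C)   ≡⟨ ⊗-assoc H H′ C ⟨
  (H ⊗ H′) ⊗ C   ∎)
  where open ≡-Reasoning

~-⊗⁻¹ : ∀ {A B} g → g ⊗ adj g ≡ I₂ → A ⊗ g ~ B → A ~ B ⊗ adj g
~-⊗⁻¹ {A} {B} g g⊗adj≡I (H , h , Ag≡HB) = H , h , (begin
  A                  ≡⟨ ⊗-identityʳ A ⟨
  A ⊗ I₂             ≡⟨ cong (A ⊗_) g⊗adj≡I ⟨
  A ⊗ (g ⊗ adj g)    ≡⟨ ⊗-assoc A g (adj g) ⟨
  (A ⊗ g) ⊗ adj g    ≡⟨ cong (_⊗ adj g) Ag≡HB ⟩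
  (H ⊗ B) ⊗ adj g    ≡⟨ ⊗-assoc H B (adj g) ⟩
  H ⊗ (B ⊗ adj g)    ∎)
  where open ≡-Reasoning

-- R x⁻¹ = (R x⁻¹ R⁻¹)² R x.
⊗-adj-~ : ∀ R x → InΓ 2 R → InΓ 2 x → R ⊗ adj x ~ R ⊗ x
⊗-adj-~ R x γR γx = y ⊗ y , sq y γy , sym (begin
  (y ⊗ y) ⊗ (R ⊗ x)                        ≡⟨ ⊗-assoc y y (R ⊗ x) ⟩
  y ⊗ (y ⊗ (R ⊗ x))                        ≡⟨ cong (y ⊗_) (⊗-assoc (R ⊗ adj x) (adj R) (R ⊗ x)) ⟩
  y ⊗ ((R ⊗ adj x) ⊗ (adj R ⊗ (R ⊗ x)))    ≡⟨ cong (λ Z → y ⊗ ((R ⊗ adj x) ⊗ Z)) (adj-cancelˡ R x (proj₁ γR)) ⟩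
  y ⊗ ((R ⊗ adj x) ⊗ x)                    ≡⟨ cong (y ⊗_) (adj-cancelʳ x R (proj₁ γx)) ⟩
  y ⊗ R                                    ≡⟨ adj-cancelʳ R (R ⊗ adj x) (proj₁ γR) ⟩
  R ⊗ adj x                                ∎)
  where
  open ≡-Reasoning
  y = (R ⊗ adj x) ⊗ adj R
  γy : InΓ 2 y
  γy = Γ-⊗ (R ⊗ adj x) (adj R) (Γ-⊗ R (adj x) γR (Γ-adj x γx)) (Γ-adj R γR)

~I₂⇒Γ2² : ∀ {A} → A ~ I₂ → InΓ2Sq A
~I₂⇒Γ2² (H , h , A≡H⊗I₂) = subst InΓ2Sq (sym (trans A≡H⊗I₂ (⊗-identityʳ H))) h

~-Γ4 : ∀ {A B} → A ~ B → InΓ 4 A → InΓ 4 B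
~-Γ4 {B = B} (H , h , A≡HB) γ =
  subst (InΓ 4) (adj-cancelˡ H B (proj₁ γH))
    (Γ-⊗ (adj H) (H ⊗ B) (Γ-adj H γH) (subst (InΓ 4) A≡HB γ))
  where
  γH = Γ2²⊆Γ4 h

upper lower : ℤ → Mat
upper x = mat 1ℤ x 0ℤ 1ℤ
lower x = mat 1ℤ 0ℤ x 1ℤ

T U : Mat
T = upper (+ 2)
U = lower (+ 2)

square : ∀ A {γ : True (InΓ? 2 A)} → InΓ2Sq (A ⊗ A)
square A {γ} = sq A (toWitness γ)

T-Γ2 : InΓ 2 T
T-Γ2 = toWitness {a? = InΓ? 2 T} _

U-Γ2 : InΓ 2 U
U-Γ2 = toWitness {a? = InΓ? 2 U} _

infix 25 _^ᵇ_

_^ᵇ_ : Mat → Bool → Mat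
X ^ᵇ false = I₂
X ^ᵇ true  = X

infix 22 T^_U^_

T^_U^_ : Bool → Bool → Mat
T^ i U^ j = T ^ᵇ i ⊗ U ^ᵇ j

TU-Γ2 : ∀ i j → InΓ 2 (T^ i U^ j)
TU-Γ2 i j = Γ-⊗ (T ^ᵇ i) (U ^ᵇ j) (power i T-Γ2) (power j U-Γ2)
  where
  power : ∀ {X} i → InΓ 2 X → InΓ 2 (X ^ᵇ i)
  power false _ = Γ-I₂ 2
  power true  γ = γ

TU-Γ4 : ∀ i j → InΓ 4 (T^ i U^ j) → T^ i U^ j ≡ I₂
TU-Γ4 false false _                     = refl
TU-Γ4 true  false (_ , _ , 4∣2 , _)     = ⊥-elim (4∤2 4∣2)
TU-Γ4 false true  (_ , _ , _ , 4∣2 , _) = ⊥-elim (4∤2 4∣2)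
TU-Γ4 true  true  (_ , _ , 4∣2 , _)     = ⊥-elim (4∤2 4∣2)

TU⊗T~ : ∀ i j → T^ i U^ j ⊗ T ~ T^ not i U^ j
TU⊗T~ false false = _ , one , refl
TU⊗T~ true  false = _ , square T , refl
-- U T (T U)⁻¹ is the commutator U T U⁻¹ T⁻¹ = U² (U⁻¹ T)² (T⁻¹)².
TU⊗T~ false true  = _ , mul (square U) (mul (square (adj U ⊗ T)) (square (adj T))) , refl
TU⊗T~ true  true  = _ , mul (square (T ⊗ U)) (square (adj U)) , refl

TU⊗U~ : ∀ i j → T^ i U^ j ⊗ U ~ T^ i U^ not j
TU⊗U~ false false = _ , one , refl
TU⊗U~ false true  = _ , square U , refl
TU⊗U~ true  false = _ , one , refl
TU⊗U~ true  true  = _ , square ((T ⊗ U) ⊗ adj T) , refl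

HasNormalForm : Mat → Set
HasNormalForm A = ∃₂ λ i j → A ~ T^ i U^ j

-- Euclidean descent

⊗-upper : ∀ a b c d k → mat a b c d ⊗ upper k ≡ mat a (b + a * k) c (d + c * k)
⊗-upper a b c d k = mat-cong (kept a b) (sheared a b k) (kept c d) (sheared c d k)
  where
  kept : ∀ x y → x * 1ℤ + y * 0ℤ ≡ x
  kept = solve-∀
  sheared : ∀ x y k → x * k + y * 1ℤ ≡ y + x * k
  sheared = solve-∀

⊗-lower : ∀ a b c d k → mat a b c d ⊗ lower k ≡ mat (a + b * k) b (c + d * k) d
⊗-lower a b c d k = mat-cong (sheared a b k) (kept a b) (sheared c d k) (kept c d)
  where
  kept : ∀ x y → x * 0ℤ + y * 1ℤ ≡ y
  kept = solve-∀
  sheared : ∀ x y k → x * 1ℤ + y * k ≡ x + y * k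
  sheared = solve-∀

upper-Γ2 : ∀ s → InΓ 2 (upper (s ◃ 2))
upper-Γ2 Sign.+ = T-Γ2
upper-Γ2 Sign.- = Γ-adj T T-Γ2

lower-Γ2 : ∀ s → InΓ 2 (lower (s ◃ 2))
lower-Γ2 Sign.+ = U-Γ2
lower-Γ2 Sign.- = Γ-adj U U-Γ2

upper-inverse : ∀ s → upper (s ◃ 2) ⊗ adj (upper (s ◃ 2)) ≡ I₂
upper-inverse Sign.+ = refl
upper-inverse Sign.- = refl

lower-inverse : ∀ s → lower (s ◃ 2) ⊗ adj (lower (s ◃ 2)) ≡ I₂
lower-inverse Sign.+ = refl
lower-inverse Sign.- = refl

upper-move-Γ2 : ∀ a b c d s → InΓ 2 (mat a b c d) → InΓ 2 (mat a (b + a * (s ◃ 2)) c (d + c * (s ◃ 2)))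
upper-move-Γ2 a b c d s γ =
  subst (InΓ 2) (⊗-upper a b c d (s ◃ 2)) (Γ-⊗ (mat a b c d) (upper (s ◃ 2)) γ (upper-Γ2 s))

lower-move-Γ2 : ∀ a b c d s → InΓ 2 (mat a b c d) → InΓ 2 (mat (a + b * (s ◃ 2)) b (c + d * (s ◃ 2)) d)
lower-move-Γ2 a b c d s γ =
  subst (InΓ 2) (⊗-lower a b c d (s ◃ 2)) (Γ-⊗ (mat a b c d) (lower (s ◃ 2)) γ (lower-Γ2 s))

lower-move-≡1 : ∀ a b s → + 4 ∣ a - 1ℤ → + 2 ∣ b → + 4 ∣ (a + b * (s ◃ 2)) - 1ℤ
lower-move-≡1 a b s 4∣a-1 2∣b =
  subst (+ 4 ∣_) (identity a b (s ◃ 2)) (∣m∣n⇒∣m+n 4∣a-1 (even*even 2∣b (±2-even s)))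
  where
  identity : ∀ a b k → (a - 1ℤ) + b * k ≡ (a + b * k) - 1ℤ
  identity = solve-∀
  ±2-even : ∀ s → + 2 ∣ s ◃ 2
  ±2-even Sign.+ = divides 1ℤ refl
  ±2-even Sign.- = divides (- 1ℤ) refl

TU⊗adj-upper~ : ∀ i j s → T^ i U^ j ⊗ adj (upper (s ◃ 2)) ~ T^ not i U^ j
TU⊗adj-upper~ i j Sign.+ = ~-trans (⊗-adj-~ (T^ i U^ j) T (TU-Γ2 i j) T-Γ2) (TU⊗T~ i j)
TU⊗adj-upper~ i j Sign.- = TU⊗T~ i j

TU⊗adj-lower~ : ∀ i j s → T^ i U^ j ⊗ adj (lower (s ◃ 2)) ~ T^ i U^ not j
TU⊗adj-lower~ i j Sign.+ = ~-trans (⊗-adj-~ (T^ i U^ j) U (TU-Γ2 i j) U-Γ2) (TU⊗U~ i j)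
TU⊗adj-lower~ i j Sign.- = TU⊗U~ i j

undo-upper : ∀ {a b c d} s →
  HasNormalForm (mat a (b + a * (s ◃ 2)) c (d + c * (s ◃ 2))) → HasNormalForm (mat a b c d)
undo-upper {a} {b} {c} {d} s (i , j , A′~TU) = not i , j ,
  ~-trans (~-⊗⁻¹ (upper (s ◃ 2)) (upper-inverse s) (subst (_~ T^ i U^ j) (sym (⊗-upper a b c d (s ◃ 2))) A′~TU))
          (TU⊗adj-upper~ i j s)

undo-lower : ∀ {a b c d} s →
  HasNormalForm (mat (a + b * (s ◃ 2)) b (c + d * (s ◃ 2)) d) → HasNormalForm (mat a b c d)
undo-lower {a} {b} {c} {d} s (i , j , A′~TU) = i , not j ,
  ~-trans (~-⊗⁻¹ (lower (s ◃ 2)) (lower-inverse s) (subst (_~ T^ i U^ j) (sym (⊗-lower a b c d (s ◃ 2))) A′~TU))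
          (TU⊗adj-lower~ i j s)

lower-⊗ : ∀ x y → lower x ⊗ lower y ≡ lower (x + y)
lower-⊗ x y = trans (⊗-lower 1ℤ 0ℤ x 1ℤ y) (cong (λ z → mat 1ℤ 0ℤ (x + z) 1ℤ) (*-identityˡ y))

lower-~ : ∀ x q → lower (x + q * + 4) ~ lower x
lower-~ x q = L ⊗ L , sq L γL , (begin
  lower (x + q * + 4)                   ≡⟨ cong lower (identity x q) ⟩
  lower ((q * + 2 + q * + 2) + x)       ≡⟨ lower-⊗ (q * + 2 + q * + 2) x ⟨
  lower (q * + 2 + q * + 2) ⊗ lower x   ≡⟨ cong (_⊗ lower x) (lower-⊗ (q * + 2) (q * + 2)) ⟨
  (L ⊗ L) ⊗ lower x                     ∎)
  where
  open ≡-Reasoning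
  L = lower (q * + 2)
  γL : InΓ 2 L
  γL = ∣⇒InΓ L refl (divides 0ℤ refl) (divides 0ℤ refl) (divides q refl) (divides 0ℤ refl)
  identity : ∀ x q → x + q * + 4 ≡ (q * + 2 + q * + 2) + x
  identity = solve-∀

even-lower-NF : ∀ {c} → + 2 ∣ c → HasNormalForm (lower c)
even-lower-NF {c} (divides k c≡k*2) =
  by-parity (k %ℕ 2) (n%ℕd<d k 2) (trans c≡k*2 (trans (cong (_* + 2) (a≡a%ℕn+[a/ℕn]*n k 2)) (identity (+ (k %ℕ 2)) q)))
  where
  q = k /ℕ 2
  identity : ∀ r q → (r + q * + 2) * + 2 ≡ r * + 2 + q * + 4
  identity = solve-∀
  by-parity : ∀ r → r ℕ.< 2 → c ≡ + r * + 2 + q * + 4 → HasNormalForm (lower c)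
  by-parity 0 _ c≡ = false , false , subst (λ z → lower z ~ T^ false U^ false) (sym c≡) (lower-~ (+ 0) q)
  by-parity 1 _ c≡ = false , true  , subst (λ z → lower z ~ T^ false U^ true) (sym c≡) (lower-~ (+ 2) q)
  by-parity (suc (suc _)) (s≤s (s≤s ())) _

unipotent : ∀ {a c d} → InΓ 2 (mat a 0ℤ c d) → + 4 ∣ a - 1ℤ → mat a 0ℤ c d ≡ lower c
unipotent {a} {c} {d} γ 4∣a-1 = cong₂ (λ x y → mat x 0ℤ c y) a≡1 d≡1
  where
  ad≡1 : a * d ≡ 1ℤ
  ad≡1 = trans (sym (+-identityʳ (a * d))) (proj₁ γ)
  a≡1 : a ≡ 1ℤ
  a≡1 = unit≡1 a (ℕ.m*n≡1⇒m≡1 ∣ a ∣ ∣ d ∣ (trans (sym (abs-* a d)) (cong ∣_∣ ad≡1))) 4∣a-1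
  d≡1 : d ≡ 1ℤ
  d≡1 = trans (sym (*-identityˡ d)) (subst (λ x → x * d ≡ 1ℤ) a≡1 ad≡1)

descent : ∀ n a b c d → InΓ 2 (mat a b c d) → + 4 ∣ a - 1ℤ → ∣ a ∣ ℕ.+ ∣ b ∣ ℕ.< n →
          HasNormalForm (mat a b c d)
descent (suc n) a b c d γ 4∣a-1 size with InΓ⇒∣ (mat a b c d) γ | b ≟ 0ℤ
... | _ , _ , 2∣c , _ | yes refl = subst HasNormalForm (sym (unipotent γ 4∣a-1)) (even-lower-NF 2∣c)
... | 2∣a-1 , 2∣b , _ | no b≢0 with ℕ.<-cmp ∣ a ∣ ∣ b ∣
...   | tri≈ _ |a|≡|b| _ = ⊥-elim (odd≢even a b |a|≡|b| 2∣a-1 2∣b)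
...   | tri< |a|<|b| _ _ with euclid-step a b (odd-nonzero a 2∣a-1) |a|<|b|
...     | s , shrinks = undo-upper s (descent n _ _ _ _ (upper-move-Γ2 a b c d s γ) 4∣a-1
                          (ℕ.<-≤-trans (ℕ.+-monoʳ-< ∣ a ∣ shrinks) (ℕ.≤-pred size)))
descent (suc n) a b c d γ 4∣a-1 size
    | 2∣a-1 , 2∣b , _ | no b≢0 | tri> _ _ |b|<|a|
    with euclid-step b a (ℕ.n≢0⇒n>0 (λ |b|≡0 → b≢0 (∣i∣≡0⇒i≡0 |b|≡0))) |b|<|a|
... | s , shrinks = undo-lower s (descent n _ _ _ _ (lower-move-Γ2 a b c d s γ) (lower-move-≡1 a b s 4∣a-1 2∣b)
                      (ℕ.<-≤-trans (ℕ.+-monoˡ-< ∣ b ∣ shrinks) (ℕ.≤-pred size)))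

Γ4⊆Γ2² : ∀ {A} → InΓ 4 A → InΓ2Sq A
Γ4⊆Γ2² {A@(mat a b c d)} γ
  with descent _ a b c d (Γ4⊆Γ2 {A} γ) (proj₁ (InΓ⇒∣ A γ)) (ℕ.n<1+n (∣ a ∣ ℕ.+ ∣ b ∣))
... | i , j , A~TU = ~I₂⇒Γ2² (subst (A ~_) (TU-Γ4 i j (~-Γ4 A~TU γ)) A~TU)

lemma9p1 : ∀ (A : Mat) → (InΓ2Sq A → InΓ 4 A) × (InΓ 4 A → InΓ2Sq A)
lemma9p1 A = Γ2²⊆Γ4 , Γ4⊆Γ2²
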